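{- The rewriting system $\upsilon'$ is terminating (there is no infinite sequence of $\upsilon'$-reduction steps).
   Context: Named variables $x,y,z,\ldots$ ($\mathsf{x}$ ranges over them). Terms and substitutions: $a,b::=\mathsf{x}\mid\underline{1}\mid ab\mid\lambda a\mid a[s]$, $s::=b/\mid\,\uparrow\,\mid id\mid\,\Uparrow\! s$. The system $\upsilon'$ consists of the following rules, applicable to any subterm (including inside substitutions $b/$ and $\Uparrow\! s$): (App) $(ab)[s]\to(a[s])(b[s])$; (Lambda) $(\lambda a)[s]\to\lambda(a[\Uparrow\! s])$; (Var) $\underline{1}[b/]\to b$; (Shift) $a[\uparrow][b/]\to a$; (VarId) $\underline{1}[id]\to\underline{1}$; (ShiftId) $a[\uparrow][id]\to a[\uparrow]$; (VarLift) $\underline{1}[\Uparrow\! s]\to\underline{1}$; (ShiftLift) $a[\uparrow][\Uparrow\! s]\to a[s][\uparrow]$. Here $a[s][t]$ means $(a[s])[t]$. -}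

module Defs where

open import Data.Nat using (ℕ; suc)

Name : Set
Name = ℕ

mutual
  -- a,b ::= x | 1 | a b | λ a | a[s]
  data Term : Set where
    var  : Name → Term
    one  : Term
    app  : Term → Term → Term
    lam  : Term → Term
    clos : Term → Subst → Term

  -- s ::= b/ | ↑ | id | ⇑ s
  data Subst : Set where
    slash : Term → Subst
    shift : Subst
    idS   : Subst
    lift  : Subst → Subst

mutual
  data _⟶_ : Term → Term → Set where
    r-App       : ∀ {a b s} → clos (app a b) s ⟶ app (clos a s) (clos b s)
    r-Lambda    : ∀ {a s} → clos (lam a) s ⟶ lam (clos a (lift s))
    r-Var       : ∀ {b} → clos one (slash b) ⟶ b
    r-Shift     : ∀ {a b} → clos (clos a shift) (slash b) ⟶ a
    r-VarId     : clos one idS ⟶ one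
    r-ShiftId   : ∀ {a} → clos (clos a shift) idS ⟶ clos a shift
    r-VarLift   : ∀ {s} → clos one (lift s) ⟶ one
    r-ShiftLift : ∀ {a s} → clos (clos a shift) (lift s) ⟶ clos (clos a s) shift
    c-appˡ  : ∀ {a a' b} → a ⟶ a' → app a b ⟶ app a' b
    c-appʳ  : ∀ {a b b'} → b ⟶ b' → app a b ⟶ app a b'
    c-lam   : ∀ {a a'} → a ⟶ a' → lam a ⟶ lam a'
    c-closˡ : ∀ {a a' s} → a ⟶ a' → clos a s ⟶ clos a' s
    c-closʳ : ∀ {a s s'} → s ⟶ˢ s' → clos a s ⟶ clos a s'

  data _⟶ˢ_ : Subst → Subst → Set where
    c-slash : ∀ {b b'} → b ⟶ b' → slash b ⟶ˢ slash b'
    c-lift  : ∀ {s s'} → s ⟶ˢ s' → lift s ⟶ˢ lift s'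

InfiniteReduction : (ℕ → Term) → Set
InfiniteReduction f = ∀ i → f i ⟶ f (suc i)

module Submission where

-- Termination of υ' by a lexicographic polynomial interpretation.
--
-- Every term a is sent to a pair μ a = (μ₁ a , μ₂ a) of natural numbers.
-- Both components are polynomial interpretations: application, abstraction
-- and b/ are interpreted additively, closure a[s] multiplicatively, and the
-- two differ only on the constants and on ⇑.  In μ₁ the lift ⇑ is
-- invisible, so seven of the eight rules make μ₁ drop strictly, while
-- ShiftLift leaves μ₁ unchanged (commutativity of ·) and makes μ₂ drop,
-- because μ₂ counts ⇑.  Since all interpretations are strictly monotone in
-- each argument, such a lexicographic decrease propagates through every
-- context, so each reduction step strictly decreases μ in the lexicographic
-- order on ℕ × ℕ.  That order is well founded, and a well-founded relation
-- admits no infinite descending sequence; hence there is no infinite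
-- reduction sequence.

open import Defs
open import Data.Nat.Base
open import Data.Nat.Induction using (<-wellFounded)
open import Data.Nat.Properties
open import Data.Nat.Tactic.RingSolver using (solve-∀)
open import Data.Product using (∃; _×_; _,_)
open import Data.Product.Relation.Binary.Lex.Strict using (×-Lex; ×-wellFounded)
open import Data.Sum using (inj₁; inj₂)
open import Function.Base using (_∘_; id)
open import Induction.InfiniteDescent using (InfiniteDescendingSequence)
open import Induction.WellFounded using (Acc; acc; WellFounded)
open import Level using (Level)
open import Relation.Binary.Core using (Rel)
open import Relation.Binary.Definitions using (Monotonic₁)
open import Relation.Binary.PropositionalEquality using (_≡_; cong; sym; subst)
open import Relation.Nullary using (¬_)

-- A well-founded relation has no infinite descending sequence: the
-- accessibility proof of the first element shrinks along the sequence.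
module _ {a r : Level} {A : Set a} {_<_ : Rel A r} where

  acc⇒noInfiniteDescent : ∀ (f : ℕ → A) → Acc _<_ (f 0) →
                          ¬ InfiniteDescendingSequence _<_ f
  acc⇒noInfiniteDescent f (acc rs) desc =
    acc⇒noInfiniteDescent (f ∘ suc) (rs (desc 0)) (desc ∘ suc)

  wf⇒noInfiniteDescent : WellFounded _<_ → ∀ (f : ℕ → A) →
                         ¬ InfiniteDescendingSequence _<_ f
  wf⇒noInfiniteDescent wf f = acc⇒noInfiniteDescent f (wf (f 0))

mutual
  μ₁ : Term → ℕ
  μ₁ (var _)    = 2
  μ₁ one        = 2
  μ₁ (app a b)  = μ₁ a + μ₁ b + 1
  μ₁ (lam a)    = μ₁ a + 1
  μ₁ (clos a s) = μ₁ a * μ₁ˢ s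

  μ₁ˢ : Subst → ℕ
  μ₁ˢ (slash b) = μ₁ b + 1
  μ₁ˢ shift     = 2
  μ₁ˢ idS       = 2
  μ₁ˢ (lift s)  = μ₁ˢ s

mutual
  μ₂ : Term → ℕ
  μ₂ (var _)    = 1
  μ₂ one        = 1
  μ₂ (app a b)  = μ₂ a + μ₂ b + 1
  μ₂ (lam a)    = μ₂ a + 1
  μ₂ (clos a s) = μ₂ a * μ₂ˢ s

  μ₂ˢ : Subst → ℕ
  μ₂ˢ (slash b) = μ₂ b + 1
  μ₂ˢ shift     = 1
  μ₂ˢ idS       = 1
  μ₂ˢ (lift s)  = μ₂ˢ s + 1

-- Lower bounds: μ₁ takes values ≥ 2 (so the rules App, Lambda and VarLift
-- decrease it) and μ₂ is positive (so multiplying by it is strictly monotone).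
mutual
  μ₁≥2 : ∀ a → 2 ≤ μ₁ a
  μ₁≥2 (var _)    = ≤-refl
  μ₁≥2 one        = ≤-refl
  μ₁≥2 (app a b)  = ≤-trans (μ₁≥2 a) (≤-trans (m≤m+n (μ₁ a) (μ₁ b)) (m≤m+n _ 1))
  μ₁≥2 (lam a)    = ≤-trans (μ₁≥2 a) (m≤m+n _ 1)
  μ₁≥2 (clos a s) = *-mono-≤ (μ₁≥2 a) (≤-trans (s≤s z≤n) (μ₁ˢ≥2 s))

  μ₁ˢ≥2 : ∀ s → 2 ≤ μ₁ˢ s
  μ₁ˢ≥2 (slash b) = ≤-trans (μ₁≥2 b) (m≤m+n _ 1)
  μ₁ˢ≥2 shift     = ≤-refl
  μ₁ˢ≥2 idS       = ≤-refl
  μ₁ˢ≥2 (lift s)  = μ₁ˢ≥2 s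

mutual
  μ₂>0 : ∀ a → 0 < μ₂ a
  μ₂>0 (var _)    = ≤-refl
  μ₂>0 one        = ≤-refl
  μ₂>0 (app a b)  = m≤n+m 1 _
  μ₂>0 (lam a)    = m≤n+m 1 _
  μ₂>0 (clos a s) = *-mono-≤ (μ₂>0 a) (μ₂ˢ>0 s)

  μ₂ˢ>0 : ∀ s → 0 < μ₂ˢ s
  μ₂ˢ>0 (slash b) = m≤n+m 1 _
  μ₂ˢ>0 shift     = ≤-refl
  μ₂ˢ>0 idS       = ≤-refl
  μ₂ˢ>0 (lift s)  = m≤n+m 1 _

μ₁>0 : ∀ a → 0 < μ₁ a
μ₁>0 a = ≤-trans (s≤s z≤n) (μ₁≥2 a)

μ₁ˢ>0 : ∀ s → 0 < μ₁ˢ s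
μ₁ˢ>0 s = ≤-trans (s≤s z≤n) (μ₁ˢ≥2 s)

μ : Term → ℕ × ℕ
μ a = μ₁ a , μ₂ a

μˢ : Subst → ℕ × ℕ
μˢ s = μ₁ˢ s , μ₂ˢ s

_≺_ : Rel (ℕ × ℕ) _
_≺_ = ×-Lex _≡_ _<_ _<_

≺-wellFounded : WellFounded _≺_
≺-wellFounded = ×-wellFounded <-wellFounded <-wellFounded

≺-map : ∀ {g h : ℕ → ℕ} → Monotonic₁ _<_ _<_ g → Monotonic₁ _<_ _<_ h →
        ∀ {x₁ x₂ y₁ y₂} → (x₁ , x₂) ≺ (y₁ , y₂) → (g x₁ , h x₂) ≺ (g y₁ , h y₂)
≺-map     g-mono h-mono (inj₁ x₁<y₁)           = inj₁ (g-mono x₁<y₁)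
≺-map {g} g-mono h-mono (inj₂ (x₁≡y₁ , x₂<y₂)) = inj₂ (cong g x₁≡y₁ , h-mono x₂<y₂)

+-+1-monoˡ-< : ∀ c → Monotonic₁ _<_ _<_ (λ z → z + c + 1)
+-+1-monoˡ-< c = +-monoˡ-< 1 ∘ +-monoˡ-< c

+-+1-monoʳ-< : ∀ c → Monotonic₁ _<_ _<_ (λ z → c + z + 1)
+-+1-monoʳ-< c = +-monoˡ-< 1 ∘ +-monoʳ-< c

*-monoˡ-<-pos : ∀ c → 0 < c → Monotonic₁ _<_ _<_ (_* c)
*-monoˡ-<-pos c c>0 = *-monoˡ-< c {{>-nonZero c>0}}

*-monoʳ-<-pos : ∀ c → 0 < c → Monotonic₁ _<_ _<_ (c *_)
*-monoʳ-<-pos c c>0 = *-monoʳ-< c {{>-nonZero c>0}}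

-- Arithmetic behind the root rules, with x, y standing for μ₁ of terms and
-- s for μ₁ˢ of a substitution; each says "reduct < redex".
<-by-excess : ∀ {x y} d → y ≡ suc d + x → x < y
<-by-excess {x} d y≡ = subst (x <_) (sym y≡) (m<n+m x z<s)

doubling : ∀ x → 0 < x → x < x * 2
doubling x x>0 = m<m*n x 2 {{>-nonZero x>0}} ≤-refl

app-decreases : ∀ x y s → 2 ≤ s → x * s + y * s + 1 < (x + y + 1) * s
app-decreases x y (suc zero)    (s≤s ())
app-decreases x y (suc (suc k)) _ = <-by-excess k (identity x y k)
  where
  identity : ∀ x y k → (x + y + 1) * (2 + k) ≡ suc k + (x * (2 + k) + y * (2 + k) + 1)
  identity = solve-∀

lam-decreases : ∀ x s → 2 ≤ s → x * s + 1 < (x + 1) * s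
lam-decreases x (suc zero)    (s≤s ())
lam-decreases x (suc (suc k)) _ = <-by-excess k (identity x k)
  where
  identity : ∀ x k → (x + 1) * (2 + k) ≡ suc k + (x * (2 + k) + 1)
  identity = solve-∀

var-decreases : ∀ y → y < 2 * (y + 1)
var-decreases y = <-by-excess (y + 1) (identity y)
  where
  identity : ∀ y → 2 * (y + 1) ≡ suc (y + 1) + y
  identity = solve-∀

shift-decreases : ∀ x y → 0 < x → x < x * 2 * (y + 1)
shift-decreases x y x>0 = <-≤-trans (doubling x x>0) (m≤m*n (x * 2) (y + 1) {{>-nonZero (m≤n+m 1 y)}})

shiftId-decreases : ∀ x → 0 < x → x * 2 < x * 2 * 2
shiftId-decreases x x>0 = doubling (x * 2) (<-trans x>0 (doubling x x>0))

varLift-decreases : ∀ s → 2 ≤ s → 2 < 2 * s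
varLift-decreases s 2≤s = m<m*n 2 s 2≤s

-- ShiftLift: μ₁ is unchanged, and μ₂ drops since ⇑ s weighs μ₂ˢ s + 1.
shiftLift-μ₁ : ∀ x s → x * s * 2 ≡ x * 2 * s
shiftLift-μ₁ = solve-∀

shiftLift-μ₂ : ∀ x s → 0 < x → x * s * 1 < x * 1 * (s + 1)
shiftLift-μ₂ x s x>0 rewrite *-identityʳ (x * s) | *-identityʳ x =
  *-monoʳ-<-pos x x>0 (m<m+n s z<s)

mutual
  ⟶-decreases : ∀ {a b} → a ⟶ b → μ b ≺ μ a
  ⟶-decreases (r-App {a} {b} {s})   = inj₁ (app-decreases (μ₁ a) (μ₁ b) (μ₁ˢ s) (μ₁ˢ≥2 s))
  ⟶-decreases (r-Lambda {a} {s})    = inj₁ (lam-decreases (μ₁ a) (μ₁ˢ s) (μ₁ˢ≥2 s))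
  ⟶-decreases (r-Var {b})           = inj₁ (var-decreases (μ₁ b))
  ⟶-decreases (r-Shift {a} {b})     = inj₁ (shift-decreases (μ₁ a) (μ₁ b) (μ₁>0 a))
  ⟶-decreases r-VarId               = inj₁ (varLift-decreases 2 ≤-refl)
  ⟶-decreases (r-ShiftId {a})       = inj₁ (shiftId-decreases (μ₁ a) (μ₁>0 a))
  ⟶-decreases (r-VarLift {s})       = inj₁ (varLift-decreases (μ₁ˢ s) (μ₁ˢ≥2 s))
  ⟶-decreases (r-ShiftLift {a} {s}) =
    inj₂ (shiftLift-μ₁ (μ₁ a) (μ₁ˢ s) , shiftLift-μ₂ (μ₂ a) (μ₂ˢ s) (μ₂>0 a))
  ⟶-decreases (c-appˡ {b = b} r)    =
    ≺-map (+-+1-monoˡ-< (μ₁ b)) (+-+1-monoˡ-< (μ₂ b)) (⟶-decreases r)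
  ⟶-decreases (c-appʳ {a} r)        =
    ≺-map (+-+1-monoʳ-< (μ₁ a)) (+-+1-monoʳ-< (μ₂ a)) (⟶-decreases r)
  ⟶-decreases (c-lam r)             =
    ≺-map (+-monoˡ-< 1) (+-monoˡ-< 1) (⟶-decreases r)
  ⟶-decreases (c-closˡ {s = s} r)   =
    ≺-map (*-monoˡ-<-pos _ (μ₁ˢ>0 s)) (*-monoˡ-<-pos _ (μ₂ˢ>0 s)) (⟶-decreases r)
  ⟶-decreases (c-closʳ {a} r)       =
    ≺-map (*-monoʳ-<-pos _ (μ₁>0 a)) (*-monoʳ-<-pos _ (μ₂>0 a)) (⟶ˢ-decreases r)

  ⟶ˢ-decreases : ∀ {s t} → s ⟶ˢ t → μˢ t ≺ μˢ s
  ⟶ˢ-decreases (c-slash r) = ≺-map (+-monoˡ-< 1) (+-monoˡ-< 1) (⟶-decreases r)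
  ⟶ˢ-decreases (c-lift r)  = ≺-map {g = id} id (+-monoˡ-< 1) (⟶ˢ-decreases r)

mainTheorem15 : ¬ (∃ λ (f : ℕ → Term) → InfiniteReduction f)
mainTheorem15 (f , reduces) =
  wf⇒noInfiniteDescent ≺-wellFounded (μ ∘ f) (⟶-decreases ∘ reduces)
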